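{- Let $G$ and $H$ be 2-symmetric graphs with $|G|\cdot|H|\ge 3$, where $|X|$ denotes the number of vertices of $X$, and let $S$ be any graph with 3 vertices. Then \[ t(S,\operatorname{inflate}(G,H))=\frac{|G|\,t(S,H)\binom{|H|}{3}+\frac12\binom{|G|}{2}\binom{|H|}{2}|H|+\binom{|G|}{3}t(S,G)|H|^3}{\binom{|G||H|}{3}}. \]
   Context: All graphs are finite simple graphs. For a graph $S$ on $k$ vertices and a graph $G$ on $n$ vertices, $t(S,G)$ is the number of $k$-element vertex subsets of $G$ inducing a subgraph isomorphic to $S$, divided by $\binom{n}{k}$; if $n<k$, $t(S,G)=0$. A graph on $n$ vertices is 2-symmetric if $n<2$, or $n\ge 2$ and its edge density is exactly $1/2$. The inflation $\operatorname{inflate}(G,H)$ is the graph with vertex set $V(G)\times V(H)$ in which $(u,a)$ and $(v,b)$ are adjacent iff either $u=v$ and $ab\in E(H)$, or $uv\in E(G)$. -}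

module Defs where

open import Data.Bool using (Bool; true; false; _∧_; _∨_; not; if_then_else_)
import Data.Bool.Properties as BoolP
open import Data.Nat using (ℕ; zero; suc; _*_; _<_; _≤_)
open import Data.Nat.Combinatorics using (_C_)
open import Data.Fin using (Fin; zero; suc; remQuot)
import Data.Fin.Properties as FinP
open import Data.List using (List; []; _∷_; [_]; map; concatMap; allFin; _++_)
open import Data.Nat.ListAction using (sum)
open import Data.Vec using (Vec; []; _∷_; lookup)
import Data.Vec as Vec
open import Data.Product using (_×_; _,_)
open import Data.Sum using (_⊎_)
open import Data.Integer using (+_)
open import Data.Rational using (ℚ; _/_; 0ℚ; ½)
open import Relation.Nullary using (does; yes; no)
open import Relation.Binary.PropositionalEquality using (_≡_; refl; sym; cong₂)

record Graph (n : ℕ) : Set where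
  field
    adj    : Fin n → Fin n → Bool
    adj-sym : ∀ i j → adj i j ≡ adj j i
    adj-irrefl : ∀ i → adj i i ≡ false
open Graph public

eqFin : ∀ {n} → Fin n → Fin n → Bool
eqFin i j = does (i FinP.≟ j)

eqBool : Bool → Bool → Bool
eqBool a b = does (a BoolP.≟ b)

allL : ∀ {A : Set} → List A → (A → Bool) → Bool
allL []       p = true
allL (x ∷ xs) p = p x ∧ allL xs p

anyL : ∀ {A : Set} → List A → (A → Bool) → Bool
anyL []       p = false
anyL (x ∷ xs) p = p x ∨ anyL xs p

countL : ∀ {A : Set} → List A → (A → Bool) → ℕ
countL xs p = sum (map (λ x → if p x then 1 else 0) xs)

-- all k-element subsets of Fin n, each listed once as a strictly
-- increasing vector of its elements
subsets : (k n : ℕ) → List (Vec (Fin n) k)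
subsets zero    n       = [ [] ]
subsets (suc k) zero    = []
subsets (suc k) (suc n) =
  map (Vec.map suc) (subsets (suc k) n) ++ map (λ v → zero ∷ Vec.map suc v) (subsets k n)

allVecs : (n k : ℕ) → List (Vec (Fin n) k)
allVecs n zero    = [ [] ]
allVecs n (suc k) = concatMap (λ i → map (i ∷_) (allVecs n k)) (allFin n)

-- Isomorphism of a graph S on Fin k with a graph on Fin k given by its
-- adjacency function T: there is a bijection π : Fin k → Fin k (an
-- injective self-map of a finite set) with  S i j = T (π i) (π j).

isoB : ∀ {k} → Graph k → (Fin k → Fin k → Bool) → Bool
isoB {k} S T = anyL (allVecs k k) λ π →
  allL (allFin k) (λ i → allL (allFin k) (λ j →
      (eqFin i j ∨ not (eqFin (lookup π i) (lookup π j)))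
    ∧ eqBool (adj S i j) (T (lookup π i) (lookup π j))))

induced : ∀ {n k} → Graph n → Vec (Fin n) k → Fin k → Fin k → Bool
induced G v i j = adj G (lookup v i) (lookup v j)

-- Rationals: a / d, with the convention a / 0 = 0 (only used where the
-- denominator is nonzero or the numerator is zero anyway)

frac : ℕ → ℕ → ℚ
frac a zero    = 0ℚ
frac a (suc d) = + a / suc d

divℕ : ℚ → ℕ → ℚ
divℕ q zero    = 0ℚ
divℕ q (suc d) = q Data.Rational.* (+ 1 / suc d)

-- Induced density t(S,G): number of k-subsets of V(G) inducing a copy
-- of S, divided by (n choose k); 0 if n < k (then the count is 0 and
-- n C k = 0 as well, and frac _ 0 = 0).

inducedCount : ∀ {k n} → Graph k → Graph n → ℕ
inducedCount {k} {n} S G = countL (subsets k n) (λ v → isoB S (induced G v))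

t : ∀ {k n} → Graph k → Graph n → ℚ
t {k} {n} S G = frac (inducedCount S G) (n C k)

edgeCount : ∀ {n} → Graph n → ℕ
edgeCount {n} G = countL (subsets 2 n) (λ v → adj G (lookup v zero) (lookup v (suc zero)))

edgeDensity : ∀ {n} → Graph n → ℚ
edgeDensity {n} G = frac (edgeCount G) (n C 2)

TwoSymmetric : ∀ {n} → Graph n → Set
TwoSymmetric {n} G = (n < 2) ⊎ ((2 ≤ n) × (edgeDensity G ≡ ½))

-- Inflation: vertex set V(G) × V(H), identified with Fin (m * n) via
-- remQuot (the inverse of Data.Fin.combine).
-- (u,a) ~ (v,b)  iff  (u = v and ab ∈ E(H))  or  uv ∈ E(G).

pairAdj : ∀ {m n} → Graph m → Graph n → Fin m × Fin n → Fin m × Fin n → Bool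
pairAdj G H (u , a) (v , b) = (eqFin u v ∧ adj H a b) ∨ adj G u v

inflAdj : ∀ {m n} → Graph m → Graph n → Fin (m * n) → Fin (m * n) → Bool
inflAdj {m} {n} G H x y = pairAdj G H (remQuot {m} n x) (remQuot {m} n y)

private
  eqFin-sym : ∀ {n} (i j : Fin n) → eqFin i j ≡ eqFin j i
  eqFin-sym i j with i FinP.≟ j | j FinP.≟ i
  ... | yes _ | yes _ = refl
  ... | no _  | no _  = refl
  ... | yes p | no q  = Data.Empty.⊥-elim (q (sym p))
    where import Data.Empty
  ... | no p  | yes q = Data.Empty.⊥-elim (p (sym q))
    where import Data.Empty

  eqFin-refl : ∀ {n} (i : Fin n) → eqFin i i ≡ true
  eqFin-refl i with i FinP.≟ i
  ... | yes _ = refl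
  ... | no p  = Data.Empty.⊥-elim (p refl)
    where import Data.Empty

pairSym : ∀ {m n} (G : Graph m) (H : Graph n) p q → pairAdj G H p q ≡ pairAdj G H q p
pairSym G H (u , a) (v , b) =
  cong₂ _∨_ (cong₂ _∧_ (eqFin-sym u v) (adj-sym H a b)) (adj-sym G u v)

pairIrrefl : ∀ {m n} (G : Graph m) (H : Graph n) p → pairAdj G H p p ≡ false
pairIrrefl G H (u , a) rewrite eqFin-refl u | adj-irrefl H a | adj-irrefl G u = refl

inflSym : ∀ {m n} (G : Graph m) (H : Graph n) x y → inflAdj G H x y ≡ inflAdj G H y x
inflSym {m} {n} G H x y = pairSym G H (remQuot {m} n x) (remQuot {m} n y)

inflIrrefl : ∀ {m n} (G : Graph m) (H : Graph n) x → inflAdj G H x x ≡ false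
inflIrrefl {m} {n} G H x = pairIrrefl G H (remQuot {m} n x)

inflate : ∀ {m n} → Graph m → Graph n → Graph (m * n)
inflate G H = record { adj = inflAdj G H ; adj-sym = inflSym G H ; adj-irrefl = inflIrrefl G H }

-- Sort the 3-subsets of V(G) × V(H) by how they meet the blocks {u} × V(H). A set inside one block
-- induces the same graph as its projection to H, and a set meeting three blocks induces the same
-- graph as its projection to G, which has |H|³ such preimages: these give the first and last terms.
-- A set with two points in one block induces a graph with edge pattern (x, y, y), x read off in H and
-- y in G. As G and H have edge density ½, the four patterns occur equally often, and they are the four
-- isomorphism types of 3-vertex graphs, so exactly a quarter of these 2·C(|G|,2)·C(|H|,2)·|H| sets
-- induce S, whatever S is.

module Submission where

module Inflation where

  open import Function using (_∘_)
  open import Data.Bool using (Bool; true; false; _∧_; _∨_; not; if_then_else_)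
  open import Data.Bool.Properties using (∨-identityʳ)
  open import Data.Nat using (ℕ; zero; suc; _+_; _*_; _^_; _≤_; z≤n; s≤s)
  open import Data.Nat.Properties
    using (+-*-semiring; +-assoc; +-comm; +-identityʳ; +-cancelˡ-≡; *-comm; *-zeroʳ; *-identityʳ;
           *-distribˡ-+; *-distribʳ-+; m≤n⇒m≤1+n; n≤0⇒n≡0)
  open import Data.Nat.Combinatorics using (_C_; nC1≡n; nCk+nC[k+1]≡[n+1]C[k+1])
  open import Data.Nat.Tactic.RingSolver using (solve-∀)
  open import Data.Fin using (Fin; zero; suc; _<_; _↑ˡ_; _↑ʳ_; combine)
  open import Data.Fin.Patterns using (0F; 1F; 2F)
  open import Data.Fin.Properties using (_≟_; <⇒≢; <-trans; remQuot-combine)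
  open import Data.Vec using (Vec; []; _∷_)
  import Data.Vec as Vec
  open import Data.List using (List; []; _∷_; _++_; map; length; allFin)
  open import Data.List.Properties using (map-++; map-∘; length-++; length-map)
  import Data.Nat.ListAction as List
  open import Data.Nat.ListAction.Properties using (sum-++)
  open import Data.Product using (_×_; _,_; proj₁; proj₂)
  open import Data.Sum using (inj₁; inj₂)
  import Data.Integer as ℤ
  import Data.Integer.Properties as ℤ
  open import Data.Rational using (ℚ; ½; fromℚᵘ; toℚᵘ) renaming (_+_ to _+ℚ_; _*_ to _*ℚ_)
  open import Data.Rational.Properties
    using (fromℚᵘ-cong; fromℚᵘ-injective; fromℚᵘ-toℚᵘ; toℚᵘ-fromℚᵘ; toℚᵘ-homo-+; toℚᵘ-homo-*)
  open import Data.Rational.Unnormalised using (mkℚᵘ; *≡*) renaming (_+_ to _+ᵘ_; _*_ to _*ᵘ_)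
  import Data.Rational.Unnormalised.Properties as ℚᵘ
  import Data.Rational.Properties as ℚ
  open import Algebra.Properties.Semiring.Sum +-*-semiring
    using (sum-syntax; sum-cong-≗; ∑-distrib-+; ∑-comm; *-distribˡ-sum)
  open import Relation.Nullary.Decidable using (dec-true; dec-false)
  open import Relation.Binary.PropositionalEquality
  open import Defs

  ∑-const : ∀ n c → ∑[ i < n ] c ≡ n * c
  ∑-const zero    c = refl
  ∑-const (suc n) c = cong (c +_) (∑-const n c)

  ∑-++ : ∀ m {n} (f : Fin (m + n) → ℕ) →
         ∑[ x < m + n ] f x ≡ ∑[ i < m ] f (i ↑ˡ n) + ∑[ j < n ] f (m ↑ʳ j)
  ∑-++ zero    f = refl
  ∑-++ (suc m) f = trans (cong (f zero +_) (∑-++ m (f ∘ suc))) (sym (+-assoc (f zero) _ _))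

  ∑-combine : ∀ m {n} (f : Fin (m * n) → ℕ) →
              ∑[ x < m * n ] f x ≡ ∑[ u < m ] ∑[ a < n ] f (combine u a)
  ∑-combine zero    f = refl
  ∑-combine (suc m) {n} f = trans (∑-++ n f) (cong (∑[ a < n ] f (a ↑ˡ m * n) +_) (∑-combine m (f ∘ (n ↑ʳ_))))

  -- Sums over pairs i < j and triples i < j < k, unfolded in the order in which subsets lists them.
  ∑₂ : ∀ n → (Fin n → Fin n → ℕ) → ℕ
  ∑₂ zero    f = 0
  ∑₂ (suc n) f = ∑₂ n (λ i j → f (suc i) (suc j)) + ∑[ j < n ] f zero (suc j)

  ∑₃ : ∀ n → (Fin n → Fin n → Fin n → ℕ) → ℕ
  ∑₃ zero    f = 0
  ∑₃ (suc n) f = ∑₃ n (λ i j k → f (suc i) (suc j) (suc k)) + ∑₂ n (λ j k → f zero (suc j) (suc k))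

  ∑₂-cong : ∀ n {f f′ : Fin n → Fin n → ℕ} →
            (∀ {i j} → i < j → f i j ≡ f′ i j) → ∑₂ n f ≡ ∑₂ n f′
  ∑₂-cong zero    eq = refl
  ∑₂-cong (suc n) eq = cong₂ _+_ (∑₂-cong n (λ {i} {j} i<j → eq {suc i} {suc j} (s≤s i<j)))
                                  (sum-cong-≗ (λ j → eq {zero} {suc j} (s≤s z≤n)))

  ∑₃-cong : ∀ n {f f′ : Fin n → Fin n → Fin n → ℕ} →
            (∀ {i j k} → i < j → j < k → f i j k ≡ f′ i j k) → ∑₃ n f ≡ ∑₃ n f′
  ∑₃-cong zero    eq = refl
  ∑₃-cong (suc n) eq =
    cong₂ _+_ (∑₃-cong n (λ {i} {j} {k} i<j j<k → eq {suc i} {suc j} {suc k} (s≤s i<j) (s≤s j<k)))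
              (∑₂-cong n (λ {j} {k} j<k → eq {zero} {suc j} {suc k} (s≤s z≤n) (s≤s j<k)))

  ∑₂-distrib-+ : ∀ n (f f′ : Fin n → Fin n → ℕ) →
                 ∑₂ n (λ i j → f i j + f′ i j) ≡ ∑₂ n f + ∑₂ n f′
  ∑₂-distrib-+ zero    f f′ = refl
  ∑₂-distrib-+ (suc n) f f′ =
    trans (cong₂ _+_ (∑₂-distrib-+ n (λ i j → f (suc i) (suc j)) (λ i j → f′ (suc i) (suc j)))
                     (∑-distrib-+ (f zero ∘ suc) (f′ zero ∘ suc)))
          (shuffle (∑₂ n (λ i j → f (suc i) (suc j))) (∑₂ n (λ i j → f′ (suc i) (suc j)))
                   (∑[ j < n ] f zero (suc j)) (∑[ j < n ] f′ zero (suc j)))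
    where shuffle : ∀ a b c d → a + b + (c + d) ≡ a + c + (b + d)
          shuffle = solve-∀

  *-distribˡ-∑₂ : ∀ n c (f : Fin n → Fin n → ℕ) → c * ∑₂ n f ≡ ∑₂ n (λ i j → c * f i j)
  *-distribˡ-∑₂ zero    c f = *-zeroʳ c
  *-distribˡ-∑₂ (suc n) c f =
    trans (*-distribˡ-+ c _ _) (cong₂ _+_ (*-distribˡ-∑₂ n c _) (*-distribˡ-sum c (f zero ∘ suc)))

  *-distribˡ-∑₃ : ∀ n c (f : Fin n → Fin n → Fin n → ℕ) →
                  c * ∑₃ n f ≡ ∑₃ n (λ i j k → c * f i j k)
  *-distribˡ-∑₃ zero    c f = *-zeroʳ c
  *-distribˡ-∑₃ (suc n) c f =
    trans (*-distribˡ-+ c _ _) (cong₂ _+_ (*-distribˡ-∑₃ n c _) (*-distribˡ-∑₂ n c _))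

  ∑₂-comm-∑ : ∀ m {n} (f : Fin m → Fin m → Fin n → ℕ) →
              ∑₂ m (λ i j → ∑[ k < n ] f i j k) ≡ ∑[ k < n ] ∑₂ m (λ i j → f i j k)
  ∑₂-comm-∑ zero    {n} f = trans (sym (*-zeroʳ n)) (sym (∑-const n 0))
  ∑₂-comm-∑ (suc m) {n} f =
    trans (cong₂ _+_ (∑₂-comm-∑ m (λ i j → f (suc i) (suc j))) (∑-comm (λ j k → f zero (suc j) k)))
          (sym (∑-distrib-+ (λ k → ∑₂ m (λ i j → f (suc i) (suc j) k)) (λ k → ∑[ j < m ] f zero (suc j) k)))

  ∑₂-const : ∀ n c → ∑₂ n (λ _ _ → c) ≡ (n C 2) * c
  ∑₂-const zero    c = refl
  ∑₂-const (suc n) c = begin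
    ∑₂ n (λ _ _ → c) + ∑[ j < n ] c  ≡⟨ cong₂ _+_ (∑₂-const n c) (∑-const n c) ⟩
    (n C 2) * c + n * c               ≡⟨ sym (*-distribʳ-+ c (n C 2) n) ⟩
    (n C 2 + n) * c                   ≡⟨ cong (_* c) (trans (cong (n C 2 +_) (sym (nC1≡n n))) pascal) ⟩
    (suc n C 2) * c                   ∎
    where
      open ≡-Reasoning
      pascal : n C 2 + n C 1 ≡ suc n C 2
      pascal = trans (+-comm (n C 2) (n C 1)) (nCk+nC[k+1]≡[n+1]C[k+1] n 1)

  ∑₂-++ : ∀ m {n} (f : Fin (m + n) → Fin (m + n) → ℕ) →
          ∑₂ (m + n) f ≡ ∑₂ m (λ i j → f (i ↑ˡ n) (j ↑ˡ n))
                       + ∑[ i < m ] ∑[ j < n ] f (i ↑ˡ n) (m ↑ʳ j)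
                       + ∑₂ n (λ i j → f (m ↑ʳ i) (m ↑ʳ j))
  ∑₂-++ zero    f = refl
  ∑₂-++ (suc m) {n} f =
    trans (cong₂ _+_ (∑₂-++ m (λ i j → f (suc i) (suc j))) (∑-++ m (f zero ∘ suc)))
          (shuffle AA AB BB (∑[ j < m ] f zero (suc j ↑ˡ n)) (∑[ j < n ] f zero (suc m ↑ʳ j)))
    where
      AA = ∑₂ m (λ i j → f (suc i ↑ˡ n) (suc j ↑ˡ n))
      AB = ∑[ i < m ] ∑[ j < n ] f (suc i ↑ˡ n) (suc m ↑ʳ j)
      BB = ∑₂ n (λ i j → f (suc m ↑ʳ i) (suc m ↑ʳ j))
      shuffle : ∀ a b c d e → a + b + c + (d + e) ≡ a + d + (e + b) + c
      shuffle = solve-∀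

  ∑₃-++ : ∀ m {n} (f : Fin (m + n) → Fin (m + n) → Fin (m + n) → ℕ) →
          ∑₃ (m + n) f ≡ ∑₃ m (λ i j k → f (i ↑ˡ n) (j ↑ˡ n) (k ↑ˡ n))
                       + ∑₂ m (λ i j → ∑[ k < n ] f (i ↑ˡ n) (j ↑ˡ n) (m ↑ʳ k))
                       + ∑[ i < m ] ∑₂ n (λ j k → f (i ↑ˡ n) (m ↑ʳ j) (m ↑ʳ k))
                       + ∑₃ n (λ i j k → f (m ↑ʳ i) (m ↑ʳ j) (m ↑ʳ k))
  ∑₃-++ zero    f = refl
  ∑₃-++ (suc m) {n} f =
    trans (cong₂ _+_ (∑₃-++ m (λ i j k → f (suc i) (suc j) (suc k)))
                     (∑₂-++ m (λ j k → f zero (suc j) (suc k))))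
          (shuffle AAA AAB ABB BBB
                   (∑₂ m (λ j k → f zero (suc j ↑ˡ n) (suc k ↑ˡ n)))
                   (∑[ j < m ] ∑[ k < n ] f zero (suc j ↑ˡ n) (suc m ↑ʳ k))
                   (∑₂ n (λ j k → f zero (suc m ↑ʳ j) (suc m ↑ʳ k))))
    where
      AAA = ∑₃ m (λ i j k → f (suc i ↑ˡ n) (suc j ↑ˡ n) (suc k ↑ˡ n))
      AAB = ∑₂ m (λ i j → ∑[ k < n ] f (suc i ↑ˡ n) (suc j ↑ˡ n) (suc m ↑ʳ k))
      ABB = ∑[ i < m ] ∑₂ n (λ j k → f (suc i ↑ˡ n) (suc m ↑ʳ j) (suc m ↑ʳ k))
      BBB = ∑₃ n (λ i j k → f (suc m ↑ʳ i) (suc m ↑ʳ j) (suc m ↑ʳ k))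
      shuffle : ∀ a b c d e f g → a + b + c + d + (e + f + g) ≡ a + e + (b + f) + (g + c) + d
      shuffle = solve-∀

  ∑₂-combine : ∀ m {n} (f : Fin (m * n) → Fin (m * n) → ℕ) →
               ∑₂ (m * n) f ≡ ∑[ u < m ] ∑₂ n (λ a b → f (combine u a) (combine u b))
                            + ∑₂ m (λ u v → ∑[ a < n ] ∑[ b < n ] f (combine u a) (combine v b))
  ∑₂-combine zero    f = refl
  ∑₂-combine (suc m) {n} f =
    trans (∑₂-++ n f)
          (trans (cong₂ (λ x y → W₀ + x + y) one-in-first-block
                        (∑₂-combine m (λ x y → f (n ↑ʳ x) (n ↑ʳ y))))
                 (shuffle W₀ B₁ _ _))
    where
      ι : Fin (suc m) → Fin n → Fin (suc m * n)
      ι = combine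
      W₀ = ∑₂ n (λ a b → f (ι zero a) (ι zero b))
      B₁ = ∑[ v < m ] ∑[ a < n ] ∑[ b < n ] f (ι zero a) (ι (suc v) b)
      one-in-first-block : ∑[ a < n ] ∑[ y < m * n ] f (ι zero a) (n ↑ʳ y) ≡ B₁
      one-in-first-block = trans (sum-cong-≗ (λ a → ∑-combine m (λ y → f (ι zero a) (n ↑ʳ y))))
                                 (∑-comm (λ a v → ∑[ b < n ] f (ι zero a) (ι (suc v) b)))
      shuffle : ∀ a b c d → a + b + (c + d) ≡ a + c + (d + b)
      shuffle = solve-∀

  -- combine orders Fin (m * n) lexicographically, so an increasing triple lies in one block, has two
  -- points in its first or in its last block, or meets three blocks.
  ∑₃-combine : ∀ m {n} (f : Fin (m * n) → Fin (m * n) → Fin (m * n) → ℕ) →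
    ∑₃ (m * n) f ≡ ∑[ u < m ] ∑₃ n (λ a b c → f (combine u a) (combine u b) (combine u c))
                 + ∑₂ m (λ u w → ∑₂ n (λ a b → ∑[ c < n ] f (combine u a) (combine u b) (combine w c)))
                 + ∑₂ m (λ u v → ∑[ a < n ] ∑₂ n (λ b c → f (combine u a) (combine v b) (combine v c)))
                 + ∑₃ m (λ u v w → ∑[ a < n ] ∑[ b < n ] ∑[ c < n ] f (combine u a) (combine v b) (combine w c))
  ∑₃-combine zero    f = refl
  ∑₃-combine (suc m) {n} f =
    trans (∑₃-++ n f)
          (trans (cong₂ _+_ (cong₂ (λ x y → W₀ + x + y) two-in-first-block one-in-first-block)
                            (∑₃-combine m (λ x y z → f (n ↑ʳ x) (n ↑ʳ y) (n ↑ʳ z))))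
                 (shuffle W₀ B₁ C₁ D₁ _ _ _ _))
    where
      ι : Fin (suc m) → Fin n → Fin (suc m * n)
      ι = combine
      W₀ = ∑₃ n (λ a b c → f (ι zero a) (ι zero b) (ι zero c))
      B₁ = ∑[ w < m ] ∑₂ n (λ a b → ∑[ c < n ] f (ι zero a) (ι zero b) (ι (suc w) c))
      C₁ = ∑[ v < m ] ∑[ a < n ] ∑₂ n (λ b c → f (ι zero a) (ι (suc v) b) (ι (suc v) c))
      D₁ = ∑₂ m (λ v w → ∑[ a < n ] ∑[ b < n ] ∑[ c < n ] f (ι zero a) (ι (suc v) b) (ι (suc w) c))
      two-in-first-block : ∑₂ n (λ a b → ∑[ z < m * n ] f (ι zero a) (ι zero b) (n ↑ʳ z)) ≡ B₁
      two-in-first-block =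
        trans (∑₂-cong n (λ {a} {b} _ → ∑-combine m (λ z → f (ι zero a) (ι zero b) (n ↑ʳ z))))
              (∑₂-comm-∑ n (λ a b w → ∑[ c < n ] f (ι zero a) (ι zero b) (ι (suc w) c)))
      one-in-first-block : ∑[ a < n ] ∑₂ (m * n) (λ y z → f (ι zero a) (n ↑ʳ y) (n ↑ʳ z)) ≡ C₁ + D₁
      one-in-first-block =
        trans (sum-cong-≗ (λ a → ∑₂-combine m (λ y z → f (ι zero a) (n ↑ʳ y) (n ↑ʳ z))))
              (trans (∑-distrib-+ (λ a → ∑[ v < m ] Cᵃ a v) (λ a → ∑₂ m (Dᵃ a)))
                     (cong₂ _+_ (∑-comm Cᵃ) (sym (∑₂-comm-∑ m (λ v w a → Dᵃ a v w)))))
        where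
          Cᵃ : Fin n → Fin m → ℕ
          Cᵃ a v = ∑₂ n (λ b c → f (ι zero a) (ι (suc v) b) (ι (suc v) c))
          Dᵃ : Fin n → Fin m → Fin m → ℕ
          Dᵃ a v w = ∑[ b < n ] ∑[ c < n ] f (ι zero a) (ι (suc v) b) (ι (suc w) c)
      shuffle : ∀ w b c d t₀ t₁ t₂ t₃ → w + b + (c + d) + (t₀ + t₁ + t₂ + t₃)
                                     ≡ w + t₀ + (t₁ + b) + (t₂ + c) + (t₃ + d)
      shuffle = solve-∀

  sum-subsets-suc : ∀ k n (F : Vec (Fin (suc n)) (suc k) → ℕ) →
    List.sum (map F (subsets (suc k) (suc n)))
      ≡ List.sum (map (F ∘ Vec.map suc) (subsets (suc k) n))
      + List.sum (map (λ v → F (zero ∷ Vec.map suc v)) (subsets k n))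
  sum-subsets-suc k n F = begin
    List.sum (map F (map (Vec.map suc) A ++ map (λ v → zero ∷ Vec.map suc v) B))
      ≡⟨ cong List.sum (map-++ F (map (Vec.map suc) A) _) ⟩
    List.sum (map F (map (Vec.map suc) A) ++ map F (map (λ v → zero ∷ Vec.map suc v) B))
      ≡⟨ sum-++ (map F (map (Vec.map suc) A)) _ ⟩
    List.sum (map F (map (Vec.map suc) A)) + List.sum (map F (map (λ v → zero ∷ Vec.map suc v) B))
      ≡⟨ cong₂ (λ x y → List.sum x + List.sum y) (sym (map-∘ A)) (sym (map-∘ B)) ⟩
    List.sum (map (F ∘ Vec.map suc) A) + List.sum (map (λ v → F (zero ∷ Vec.map suc v)) B) ∎
    where
      open ≡-Reasoning
      A = subsets (suc k) n
      B = subsets k n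

  ∑₁-subsets : ∀ n (F : Vec (Fin n) 1 → ℕ) → List.sum (map F (subsets 1 n)) ≡ ∑[ i < n ] F (i ∷ [])
  ∑₁-subsets zero    F = refl
  ∑₁-subsets (suc n) F =
    trans (sum-subsets-suc 0 n F)
          (trans (cong₂ _+_ (∑₁-subsets n (F ∘ Vec.map suc)) (+-identityʳ (F (zero ∷ []))))
                 (+-comm _ (F (zero ∷ []))))

  ∑₂-subsets : ∀ n (F : Vec (Fin n) 2 → ℕ) →
               List.sum (map F (subsets 2 n)) ≡ ∑₂ n (λ i j → F (i ∷ j ∷ []))
  ∑₂-subsets zero    F = refl
  ∑₂-subsets (suc n) F =
    trans (sum-subsets-suc 1 n F)
          (cong₂ _+_ (∑₂-subsets n (F ∘ Vec.map suc)) (∑₁-subsets n (λ v → F (zero ∷ Vec.map suc v))))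

  ∑₃-subsets : ∀ n (F : Vec (Fin n) 3 → ℕ) →
               List.sum (map F (subsets 3 n)) ≡ ∑₃ n (λ i j k → F (i ∷ j ∷ k ∷ []))
  ∑₃-subsets zero    F = refl
  ∑₃-subsets (suc n) F =
    trans (sum-subsets-suc 2 n F)
          (cong₂ _+_ (∑₃-subsets n (F ∘ Vec.map suc)) (∑₂-subsets n (λ v → F (zero ∷ Vec.map suc v))))

  length-subsets : ∀ k n → length (subsets k n) ≡ n C k
  length-subsets zero    n       = refl
  length-subsets (suc k) zero    = refl
  length-subsets (suc k) (suc n) = begin
    length (map (Vec.map suc) (subsets (suc k) n) ++ map (λ v → zero ∷ Vec.map suc v) (subsets k n))
      ≡⟨ length-++ (map (Vec.map suc) (subsets (suc k) n)) ⟩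
    length (map (Vec.map suc) (subsets (suc k) n)) + length (map (λ v → zero ∷ Vec.map suc v) (subsets k n))
      ≡⟨ cong₂ _+_ (trans (length-map _ (subsets (suc k) n)) (length-subsets (suc k) n))
                   (trans (length-map _ (subsets k n)) (length-subsets k n)) ⟩
    n C suc k + n C k
      ≡⟨ +-comm (n C suc k) _ ⟩
    n C k + n C suc k
      ≡⟨ nCk+nC[k+1]≡[n+1]C[k+1] n k ⟩
    suc n C suc k ∎
    where
      open ≡-Reasoning

  countL≤length : ∀ {A : Set} (xs : List A) p → countL xs p ≤ length xs
  countL≤length []       p = z≤n
  countL≤length (x ∷ xs) p with p x
  ... | true  = s≤s (countL≤length xs p)
  ... | false = m≤n⇒m≤1+n (countL≤length xs p)

  inducedCount-vanishes : ∀ {k n} (S : Graph k) (G : Graph n) → n C k ≡ 0 → inducedCount S G ≡ 0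
  inducedCount-vanishes {k} {n} S G nCk≡0 =
    n≤0⇒n≡0 (subst (inducedCount S G ≤_) (trans (length-subsets k n) nCk≡0)
                   (countL≤length (subsets k n) (λ v → isoB S (induced G v))))

  𝟙 : Bool → ℕ
  𝟙 b = if b then 1 else 0

  triangleAdj : Bool → Bool → Bool → Fin 3 → Fin 3 → Bool
  triangleAdj x y z 0F 1F = x
  triangleAdj x y z 1F 0F = x
  triangleAdj x y z 0F 2F = y
  triangleAdj x y z 2F 0F = y
  triangleAdj x y z 1F 2F = z
  triangleAdj x y z 2F 1F = z
  triangleAdj x y z _  _  = false

  triangle : Bool → Bool → Bool → Graph 3
  triangle x y z = record { adj = triangleAdj x y z ; adj-sym = sym′ ; adj-irrefl = irrefl }
    where
      sym′ : ∀ i j → triangleAdj x y z i j ≡ triangleAdj x y z j i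
      sym′ 0F 0F = refl
      sym′ 0F 1F = refl
      sym′ 0F 2F = refl
      sym′ 1F 0F = refl
      sym′ 1F 1F = refl
      sym′ 1F 2F = refl
      sym′ 2F 0F = refl
      sym′ 2F 1F = refl
      sym′ 2F 2F = refl
      irrefl : ∀ i → triangleAdj x y z i i ≡ false
      irrefl 0F = refl
      irrefl 1F = refl
      irrefl 2F = refl

  triangleAdj-unique : (T : Fin 3 → Fin 3 → Bool) → (∀ i j → T i j ≡ T j i) → (∀ i → T i i ≡ false) →
                       ∀ i j → T i j ≡ triangleAdj (T 0F 1F) (T 0F 2F) (T 1F 2F) i j
  triangleAdj-unique T sym′ irrefl 0F 0F = irrefl 0F
  triangleAdj-unique T sym′ irrefl 0F 1F = refl
  triangleAdj-unique T sym′ irrefl 0F 2F = refl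
  triangleAdj-unique T sym′ irrefl 1F 0F = sym′ 1F 0F
  triangleAdj-unique T sym′ irrefl 1F 1F = irrefl 1F
  triangleAdj-unique T sym′ irrefl 1F 2F = refl
  triangleAdj-unique T sym′ irrefl 2F 0F = sym′ 2F 0F
  triangleAdj-unique T sym′ irrefl 2F 1F = sym′ 2F 1F
  triangleAdj-unique T sym′ irrefl 2F 2F = irrefl 2F

  anyL-cong : ∀ {A : Set} (xs : List A) {p q : A → Bool} → (∀ x → p x ≡ q x) → anyL xs p ≡ anyL xs q
  anyL-cong []       eq = refl
  anyL-cong (x ∷ xs) eq = cong₂ _∨_ (eq x) (anyL-cong xs eq)

  allL-cong : ∀ {A : Set} (xs : List A) {p q : A → Bool} → (∀ x → p x ≡ q x) → allL xs p ≡ allL xs q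
  allL-cong []       eq = refl
  allL-cong (x ∷ xs) eq = cong₂ _∧_ (eq x) (allL-cong xs eq)

  isoB-congˡ : ∀ {k} (S S′ : Graph k) T → (∀ i j → adj S i j ≡ adj S′ i j) → isoB S T ≡ isoB S′ T
  isoB-congˡ {k} S S′ T eq =
    anyL-cong (allVecs k k) λ π → allL-cong (allFin k) λ i → allL-cong (allFin k) λ j →
      cong (λ s → _ ∧ eqBool s (T (Vec.lookup π i) (Vec.lookup π j))) (eq i j)

  isoB-congʳ : ∀ {k} (S : Graph k) {T T′} → (∀ i j → T i j ≡ T′ i j) → isoB S T ≡ isoB S T′
  isoB-congʳ {k} S eq =
    anyL-cong (allVecs k k) λ π → allL-cong (allFin k) λ i → allL-cong (allFin k) λ j →
      cong (λ t → _ ∧ eqBool (adj S i j) t) (eq _ _)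

  copies : Graph 3 → Bool → Bool → Bool → ℕ
  copies S x y z = 𝟙 (isoB S (triangleAdj x y z))

  copies-cong : ∀ (S : Graph 3) {x x′ y y′ z z′} → x ≡ x′ → y ≡ y′ → z ≡ z′ →
                copies S x y z ≡ copies S x′ y′ z′
  copies-cong S refl refl refl = refl

  copiesAt : ∀ {n} → Graph 3 → Graph n → Fin n → Fin n → Fin n → ℕ
  copiesAt S K i j k = copies S (adj K i j) (adj K i k) (adj K j k)

  inducedCount-∑₃ : ∀ {n} (S : Graph 3) (K : Graph n) → inducedCount S K ≡ ∑₃ n (copiesAt S K)
  inducedCount-∑₃ {n} S K =
    trans (∑₃-subsets n (λ v → 𝟙 (isoB S (induced K v))))
          (∑₃-cong n (λ {i} {j} {k} _ _ → cong 𝟙 (isoB-congʳ S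
             (triangleAdj-unique (induced K (i ∷ j ∷ k ∷ [])) (λ _ _ → adj-sym K _ _) (λ _ → adj-irrefl K _)))))

  copies-triangle : ∀ (S : Graph 3) x y z →
                    copies S x y z ≡ copies (triangle (adj S 0F 1F) (adj S 0F 2F) (adj S 1F 2F)) x y z
  copies-triangle S x y z =
    cong 𝟙 (isoB-congˡ S (triangle (adj S 0F 1F) (adj S 0F 2F) (adj S 1F 2F)) (triangleAdj x y z)
                       (triangleAdj-unique (adj S) (adj-sym S) (adj-irrefl S)))

  -- Each quadruple of edge patterns runs once through the four isomorphism types of 3-vertex graphs.
  triangle-classes : ∀ a b c → let T = triangle a b c in
      copies T true true true + copies T false true true + (copies T true false false + copies T false false false) ≡ 1
    × copies T true true true + copies T true true false + (copies T false false true + copies T false false false) ≡ 1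
  triangle-classes false false false = refl , refl
  triangle-classes false false true  = refl , refl
  triangle-classes false true  false = refl , refl
  triangle-classes false true  true  = refl , refl
  triangle-classes true  false false = refl , refl
  triangle-classes true  false true  = refl , refl
  triangle-classes true  true  false = refl , refl
  triangle-classes true  true  true  = refl , refl

  copies-xyy : ∀ (S : Graph 3) →
    copies S true true true + copies S false true true + (copies S true false false + copies S false false false) ≡ 1
  copies-xyy S
    rewrite copies-triangle S true true true | copies-triangle S false true true
          | copies-triangle S true false false | copies-triangle S false false false
    = proj₁ (triangle-classes (adj S 0F 1F) (adj S 0F 2F) (adj S 1F 2F))

  copies-yyx : ∀ (S : Graph 3) →
    copies S true true true + copies S true true false + (copies S false false true + copies S false false false) ≡ 1
  copies-yyx S
    rewrite copies-triangle S true true true | copies-triangle S true true false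
          | copies-triangle S false false true | copies-triangle S false false false
    = proj₂ (triangle-classes (adj S 0F 1F) (adj S 0F 2F) (adj S 1F 2F))

  HalfDense : ∀ {n} → Graph n → Set
  HalfDense {n} G = 2 * edgeCount G ≡ n C 2

  edgeCount-∑₂ : ∀ {n} (G : Graph n) → edgeCount G ≡ ∑₂ n (λ i j → 𝟙 (adj G i j))
  edgeCount-∑₂ {n} G = ∑₂-subsets n _

  𝟙-not : ∀ b → 𝟙 b + 𝟙 (not b) ≡ 1
  𝟙-not true  = refl
  𝟙-not false = refl

  nonEdgeCount-halfDense : ∀ {n} (G : Graph n) → HalfDense G →
                           ∑₂ n (λ i j → 𝟙 (not (adj G i j))) ≡ edgeCount G
  nonEdgeCount-halfDense {n} G half = +-cancelˡ-≡ (edgeCount G) _ _ (begin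
    edgeCount G + ∑₂ n (λ i j → 𝟙 (not (adj G i j)))
      ≡⟨ cong (_+ ∑₂ n (λ i j → 𝟙 (not (adj G i j)))) (edgeCount-∑₂ G) ⟩
    ∑₂ n (λ i j → 𝟙 (adj G i j)) + ∑₂ n (λ i j → 𝟙 (not (adj G i j)))
      ≡⟨ sym (∑₂-distrib-+ n _ _) ⟩
    ∑₂ n (λ i j → 𝟙 (adj G i j) + 𝟙 (not (adj G i j)))
      ≡⟨ ∑₂-cong n (λ {i} {j} _ → 𝟙-not (adj G i j)) ⟩
    ∑₂ n (λ _ _ → 1)
      ≡⟨ trans (∑₂-const n 1) (*-identityʳ (n C 2)) ⟩
    n C 2
      ≡⟨ sym half ⟩
    2 * edgeCount G
      ≡⟨ cong (edgeCount G +_) (+-identityʳ (edgeCount G)) ⟩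
    edgeCount G + edgeCount G ∎)
    where open ≡-Reasoning

  bool-split : ∀ (φ : Bool → ℕ) b → φ b ≡ φ true * 𝟙 b + φ false * 𝟙 (not b)
  bool-split φ true  = sym (trans (cong₂ _+_ (*-identityʳ (φ true)) (*-zeroʳ (φ false))) (+-identityʳ (φ true)))
  bool-split φ false = sym (cong₂ _+_ (*-zeroʳ (φ true)) (*-identityʳ (φ false)))

  ∑₂-adj-halfDense : ∀ {n} (G : Graph n) → HalfDense G → (φ : Bool → ℕ) →
                     ∑₂ n (λ i j → φ (adj G i j)) ≡ edgeCount G * (φ true + φ false)
  ∑₂-adj-halfDense {n} G half φ = begin
    ∑₂ n (λ i j → φ (adj G i j))
      ≡⟨ ∑₂-cong n (λ {i} {j} _ → bool-split φ (adj G i j)) ⟩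
    ∑₂ n (λ i j → φ true * 𝟙 (adj G i j) + φ false * 𝟙 (not (adj G i j)))
      ≡⟨ ∑₂-distrib-+ n _ _ ⟩
    ∑₂ n (λ i j → φ true * 𝟙 (adj G i j)) + ∑₂ n (λ i j → φ false * 𝟙 (not (adj G i j)))
      ≡⟨ sym (cong₂ _+_ (*-distribˡ-∑₂ n (φ true) _) (*-distribˡ-∑₂ n (φ false) _)) ⟩
    φ true * ∑₂ n (λ i j → 𝟙 (adj G i j)) + φ false * ∑₂ n (λ i j → 𝟙 (not (adj G i j)))
      ≡⟨ cong₂ (λ e e′ → φ true * e + φ false * e′) (sym (edgeCount-∑₂ G)) (nonEdgeCount-halfDense G half) ⟩
    φ true * edgeCount G + φ false * edgeCount G
      ≡⟨ sym (trans (*-comm (edgeCount G) _) (*-distribʳ-+ (edgeCount G) (φ true) (φ false))) ⟩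
    edgeCount G * (φ true + φ false) ∎
    where open ≡-Reasoning

  ∑₂-∑₂-halfDense : ∀ {g h} (G : Graph g) (H : Graph h) → HalfDense G → HalfDense H →
    (ψ : Bool → Bool → ℕ) →
    ∑₂ g (λ u v → h * ∑₂ h (λ a b → ψ (adj G u v) (adj H a b)))
      ≡ edgeCount G * (h * (edgeCount H * (ψ true true + ψ true false + (ψ false true + ψ false false))))
  ∑₂-∑₂-halfDense {g} {h} G H halfG halfH ψ =
    trans (∑₂-cong g (λ {u} {v} _ → cong (h *_) (∑₂-adj-halfDense H halfH (ψ (adj G u v)))))
          (trans (∑₂-adj-halfDense G halfG (λ y → h * (edgeCount H * (ψ y true + ψ y false))))
                 (cong (edgeCount G *_)
                       (collect h (edgeCount H) (ψ true true) (ψ true false) (ψ false true) (ψ false false))))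
    where
      collect : ∀ h e a b c d → h * (e * (a + b)) + h * (e * (c + d)) ≡ h * (e * (a + b + (c + d)))
      collect = solve-∀

  eqFin-refl : ∀ {n} (i : Fin n) → eqFin i i ≡ true
  eqFin-refl i = dec-true (i ≟ i) refl

  eqFin-≢ : ∀ {n} {i j : Fin n} → i ≢ j → eqFin i j ≡ false
  eqFin-≢ {i = i} {j} = dec-false (i ≟ j)

  adj-inflate : ∀ {m n} (G : Graph m) (H : Graph n) u a v b →
                adj (inflate G H) (combine u a) (combine v b) ≡ (eqFin u v ∧ adj H a b) ∨ adj G u v
  adj-inflate {m} {n} G H u a v b =
    cong₂ (pairAdj G H) (remQuot-combine {m} {n} u a) (remQuot-combine {m} {n} v b)

  adj-inflate-inside : ∀ {m n} (G : Graph m) (H : Graph n) u a b →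
                       adj (inflate G H) (combine u a) (combine u b) ≡ adj H a b
  adj-inflate-inside G H u a b
    rewrite adj-inflate G H u a u b | eqFin-refl u | adj-irrefl G u = ∨-identityʳ (adj H a b)

  adj-inflate-across : ∀ {m n} (G : Graph m) (H : Graph n) {u v} a b → u ≢ v →
                       adj (inflate G H) (combine u a) (combine v b) ≡ adj G u v
  adj-inflate-across G H {u} {v} a b u≢v
    rewrite adj-inflate G H u a v b | eqFin-≢ u≢v = refl

  module _ {g h} (G : Graph g) (H : Graph h) (S : Graph 3) where

    private
      K = inflate G H
      τ = copiesAt S K
      ι : Fin g → Fin h → Fin (g * h)
      ι = combine

    count-within-blocks : ∑[ u < g ] ∑₃ h (λ a b c → τ (ι u a) (ι u b) (ι u c)) ≡ g * inducedCount S H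
    count-within-blocks =
      trans (sum-cong-≗ (λ u → trans (∑₃-cong h (λ {a} {b} {c} _ _ → copies-cong S
                                         (adj-inflate-inside G H u a b) (adj-inflate-inside G H u a c)
                                         (adj-inflate-inside G H u b c)))
                                     (sym (inducedCount-∑₃ S H))))
            (∑-const g (inducedCount S H))

    count-across-blocks :
      ∑₃ g (λ u v w → ∑[ a < h ] ∑[ b < h ] ∑[ c < h ] τ (ι u a) (ι v b) (ι w c)) ≡ h ^ 3 * inducedCount S G
    count-across-blocks = begin
      _ ≡⟨ ∑₃-cong g (λ {u} {v} {w} u<v v<w → sum-cong-≗ (λ a → sum-cong-≗ (λ b → sum-cong-≗ (λ c →
             copies-cong S (adj-inflate-across G H a b (<⇒≢ u<v))
                           (adj-inflate-across G H a c (<⇒≢ (<-trans u<v v<w)))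
                           (adj-inflate-across G H b c (<⇒≢ v<w)))))) ⟩
      ∑₃ g (λ u v w → ∑[ a < h ] ∑[ b < h ] ∑[ c < h ] copiesAt S G u v w)
        ≡⟨ ∑₃-cong g (λ _ _ → ∑-const³ _) ⟩
      ∑₃ g (λ u v w → h ^ 3 * copiesAt S G u v w)
        ≡⟨ sym (trans (cong (h ^ 3 *_) (inducedCount-∑₃ S G)) (*-distribˡ-∑₃ g (h ^ 3) _)) ⟩
      h ^ 3 * inducedCount S G ∎
      where
        open ≡-Reasoning
        ∑-const³ : ∀ x → ∑[ a < h ] ∑[ b < h ] ∑[ c < h ] x ≡ h ^ 3 * x
        ∑-const³ x =
          trans (sum-cong-≗ {h} (λ _ → trans (sum-cong-≗ {h} (λ _ → ∑-const h x)) (∑-const h (h * x))))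
                (trans (∑-const h (h * (h * x))) (cube h x))
          where cube : ∀ h x → h * (h * (h * x)) ≡ h * (h * (h * 1)) * x
                cube = solve-∀

    module _ (halfG : HalfDense G) (halfH : HalfDense H) where

      count-two-in-first-block :
        ∑₂ g (λ u w → ∑₂ h (λ a b → ∑[ c < h ] τ (ι u a) (ι u b) (ι w c))) ≡ edgeCount G * (h * edgeCount H)
      count-two-in-first-block = begin
        _ ≡⟨ ∑₂-cong g (λ {u} {w} u<w → ∑₂-cong h (λ {a} {b} _ → sum-cong-≗ (λ c →
               copies-cong S (adj-inflate-inside G H u a b) (adj-inflate-across G H a c (<⇒≢ u<w))
                             (adj-inflate-across G H b c (<⇒≢ u<w))))) ⟩
        ∑₂ g (λ u w → ∑₂ h (λ a b → ∑[ c < h ] copies S (adj H a b) (adj G u w) (adj G u w)))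
          ≡⟨ ∑₂-cong g (λ _ → trans (∑₂-cong h (λ _ → ∑-const h _)) (sym (*-distribˡ-∑₂ h h _))) ⟩
        ∑₂ g (λ u w → h * ∑₂ h (λ a b → copies S (adj H a b) (adj G u w) (adj G u w)))
          ≡⟨ ∑₂-∑₂-halfDense G H halfG halfH (λ y x → copies S x y y) ⟩
        edgeCount G * (h * (edgeCount H * (copies S true true true + copies S false true true
                                           + (copies S true false false + copies S false false false))))
          ≡⟨ cong (λ n → edgeCount G * (h * (edgeCount H * n))) (copies-xyy S) ⟩
        edgeCount G * (h * (edgeCount H * 1))
          ≡⟨ cong (λ n → edgeCount G * (h * n)) (*-identityʳ (edgeCount H)) ⟩
        edgeCount G * (h * edgeCount H) ∎
        where open ≡-Reasoning

      count-two-in-last-block :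
        ∑₂ g (λ u v → ∑[ a < h ] ∑₂ h (λ b c → τ (ι u a) (ι v b) (ι v c))) ≡ edgeCount G * (h * edgeCount H)
      count-two-in-last-block = begin
        _ ≡⟨ ∑₂-cong g (λ {u} {v} u<v → sum-cong-≗ (λ a → ∑₂-cong h (λ {b} {c} _ →
               copies-cong S (adj-inflate-across G H a b (<⇒≢ u<v)) (adj-inflate-across G H a c (<⇒≢ u<v))
                             (adj-inflate-inside G H v b c)))) ⟩
        ∑₂ g (λ u v → ∑[ a < h ] ∑₂ h (λ b c → copies S (adj G u v) (adj G u v) (adj H b c)))
          ≡⟨ ∑₂-cong g (λ _ → ∑-const h _) ⟩
        ∑₂ g (λ u v → h * ∑₂ h (λ b c → copies S (adj G u v) (adj G u v) (adj H b c)))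
          ≡⟨ ∑₂-∑₂-halfDense G H halfG halfH (λ y x → copies S y y x) ⟩
        edgeCount G * (h * (edgeCount H * (copies S true true true + copies S true true false
                                           + (copies S false false true + copies S false false false))))
          ≡⟨ cong (λ n → edgeCount G * (h * (edgeCount H * n))) (copies-yyx S) ⟩
        edgeCount G * (h * (edgeCount H * 1))
          ≡⟨ cong (λ n → edgeCount G * (h * n)) (*-identityʳ (edgeCount H)) ⟩
        edgeCount G * (h * edgeCount H) ∎
        where open ≡-Reasoning

      inducedCount-inflate :
        inducedCount S K ≡ g * inducedCount S H + edgeCount G * (h C 2) * h + inducedCount S G * h ^ 3
      inducedCount-inflate = begin
        inducedCount S K
          ≡⟨ trans (inducedCount-∑₃ S K) (∑₃-combine g τ) ⟩
        _ ≡⟨ cong₂ _+_ (cong₂ _+_ (cong₂ _+_ count-within-blocks count-two-in-first-block) count-two-in-last-block)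
                       count-across-blocks ⟩
        g * NH + eG * (h * eH) + eG * (h * eH) + h ^ 3 * NG
          ≡⟨ collect g NH eG eH h NG ⟩
        g * NH + eG * (2 * eH) * h + NG * h ^ 3
          ≡⟨ cong (λ c → g * NH + eG * c * h + NG * h ^ 3) halfH ⟩
        g * NH + eG * (h C 2) * h + NG * h ^ 3 ∎
        where
          open ≡-Reasoning
          NH = inducedCount S H
          NG = inducedCount S G
          eG = edgeCount G
          eH = edgeCount H
          collect : ∀ g n e f h m → g * n + e * (h * f) + e * (h * f) + h * (h * (h * 1)) * m
                                  ≡ g * n + e * (2 * f) * h + m * (h * (h * (h * 1)))
          collect = solve-∀

  fromℚᵘ-homo-+ : ∀ p q → fromℚᵘ (p +ᵘ q) ≡ fromℚᵘ p +ℚ fromℚᵘ q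
  fromℚᵘ-homo-+ p q = begin
    fromℚᵘ (p +ᵘ q)
      ≡⟨ fromℚᵘ-cong (ℚᵘ.+-cong (ℚᵘ.≃-sym (toℚᵘ-fromℚᵘ p)) (ℚᵘ.≃-sym (toℚᵘ-fromℚᵘ q))) ⟩
    fromℚᵘ (toℚᵘ (fromℚᵘ p) +ᵘ toℚᵘ (fromℚᵘ q))
      ≡⟨ fromℚᵘ-cong (ℚᵘ.≃-sym (toℚᵘ-homo-+ (fromℚᵘ p) (fromℚᵘ q))) ⟩
    fromℚᵘ (toℚᵘ (fromℚᵘ p +ℚ fromℚᵘ q))
      ≡⟨ fromℚᵘ-toℚᵘ _ ⟩
    fromℚᵘ p +ℚ fromℚᵘ q ∎
    where open ≡-Reasoning

  fromℚᵘ-homo-* : ∀ p q → fromℚᵘ (p *ᵘ q) ≡ fromℚᵘ p *ℚ fromℚᵘ q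
  fromℚᵘ-homo-* p q = begin
    fromℚᵘ (p *ᵘ q)
      ≡⟨ fromℚᵘ-cong (ℚᵘ.*-cong (ℚᵘ.≃-sym (toℚᵘ-fromℚᵘ p)) (ℚᵘ.≃-sym (toℚᵘ-fromℚᵘ q))) ⟩
    fromℚᵘ (toℚᵘ (fromℚᵘ p) *ᵘ toℚᵘ (fromℚᵘ q))
      ≡⟨ fromℚᵘ-cong (ℚᵘ.≃-sym (toℚᵘ-homo-* (fromℚᵘ p) (fromℚᵘ q))) ⟩
    fromℚᵘ (toℚᵘ (fromℚᵘ p *ℚ fromℚᵘ q))
      ≡⟨ fromℚᵘ-toℚᵘ _ ⟩
    fromℚᵘ p *ℚ fromℚᵘ q ∎
    where open ≡-Reasoning

  frac-cong : ∀ a b c d → a * suc d ≡ c * suc b → frac a (suc b) ≡ frac c (suc d)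
  frac-cong a b c d eq =
    fromℚᵘ-cong {mkℚᵘ (ℤ.+ a) b} {mkℚᵘ (ℤ.+ c) d}
      (*≡* (trans (sym (ℤ.pos-* a (suc d))) (trans (cong ℤ.+_ eq) (ℤ.pos-* c (suc b)))))

  frac-injective : ∀ a b c d → frac a (suc b) ≡ frac c (suc d) → a * suc d ≡ c * suc b
  frac-injective a b c d eq with fromℚᵘ-injective {mkℚᵘ (ℤ.+ a) b} {mkℚᵘ (ℤ.+ c) d} eq
  ... | *≡* cross = ℤ.+-injective (trans (ℤ.pos-* a (suc d)) (trans cross (sym (ℤ.pos-* c (suc b)))))

  frac-+ : ∀ a b c d → frac a (suc b) +ℚ frac c (suc d) ≡ frac (a * suc d + c * suc b) (suc b * suc d)
  frac-+ a b c d = sym (trans (cong (λ n → fromℚᵘ (mkℚᵘ n (d + b * suc d))) numerator)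
                              (fromℚᵘ-homo-+ (mkℚᵘ (ℤ.+ a) b) (mkℚᵘ (ℤ.+ c) d)))
    where numerator : ℤ.+ (a * suc d + c * suc b) ≡ ℤ.+ a ℤ.* ℤ.+ suc d ℤ.+ ℤ.+ c ℤ.* ℤ.+ suc b
          numerator = trans (ℤ.pos-+ (a * suc d) (c * suc b))
                            (cong₂ ℤ._+_ (ℤ.pos-* a (suc d)) (ℤ.pos-* c (suc b)))

  frac-* : ∀ a b c d → frac a (suc b) *ℚ frac c (suc d) ≡ frac (a * c) (suc b * suc d)
  frac-* a b c d = sym (trans (cong (λ n → fromℚᵘ (mkℚᵘ n (d + b * suc d))) (ℤ.pos-* a c))
                              (fromℚᵘ-homo-* (mkℚᵘ (ℤ.+ a) b) (mkℚᵘ (ℤ.+ c) d)))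

  fromℕ : ℕ → ℚ
  fromℕ n = frac n 1

  fromℕ-homo-+ : ∀ m n → fromℕ (m + n) ≡ fromℕ m +ℚ fromℕ n
  fromℕ-homo-+ m n =
    sym (trans (frac-+ m 0 n 0) (cong (λ k → frac k 1) (cong₂ _+_ (*-identityʳ m) (*-identityʳ n))))

  fromℕ-homo-* : ∀ m n → fromℕ (m * n) ≡ fromℕ m *ℚ fromℕ n
  fromℕ-homo-* m n = sym (frac-* m 0 n 0)

  frac-*-denominator : ∀ a c → (c ≡ 0 → a ≡ 0) → frac a c *ℚ fromℕ c ≡ fromℕ a
  frac-*-denominator a zero    a≡0 rewrite a≡0 refl = refl
  frac-*-denominator a (suc d) _   =
    trans (frac-* a d (suc d) 0) (frac-cong (a * suc d) _ a 0 (identity a d))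
    where identity : ∀ a d → a * suc d * 1 ≡ a * (suc d * 1)
          identity = solve-∀

  frac-divℕ : ∀ a c → frac a c ≡ divℕ (fromℕ a) c
  frac-divℕ a zero    = refl
  frac-divℕ a (suc d) = sym (trans (frac-* a 0 1 d) (frac-cong (a * 1) _ a d (identity a d)))
    where identity : ∀ a d → a * 1 * suc d ≡ a * (1 * suc d)
          identity = solve-∀

  ½-*-double : ∀ n → ½ *ℚ fromℕ (2 * n) ≡ fromℕ n
  ½-*-double n = trans (frac-* 1 1 (2 * n) 0) (frac-cong (1 * (2 * n)) _ n 0 (identity n))
    where identity : ∀ n → 1 * (2 * n) * 1 ≡ n * 2
          identity = solve-∀

  frac≡½⇒double : ∀ a c → frac a c ≡ ½ → 2 * a ≡ c
  frac≡½⇒double a zero    ()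
  frac≡½⇒double a (suc d) eq = trans (*-comm 2 a) (trans (frac-injective a d 1 1 eq) (+-identityʳ (suc d)))

  t-*-choose : ∀ {k n} (S : Graph k) (G : Graph n) → t S G *ℚ fromℕ (n C k) ≡ fromℕ (inducedCount S G)
  t-*-choose {k} {n} S G = frac-*-denominator (inducedCount S G) (n C k) (inducedCount-vanishes S G)

  twoSymmetric⇒halfDense : ∀ {n} (G : Graph n) → TwoSymmetric G → HalfDense G
  twoSymmetric⇒halfDense {0}           G _                  = refl
  twoSymmetric⇒halfDense {1}           G _                  = refl
  twoSymmetric⇒halfDense {suc (suc n)} G (inj₁ (s≤s (s≤s ())))
  twoSymmetric⇒halfDense {suc (suc n)} G (inj₂ (_ , density≡½)) = frac≡½⇒double (edgeCount G) _ density≡½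

  inflate-numerator : ∀ {g h} (G : Graph g) (H : Graph h) (S : Graph 3) → TwoSymmetric G → TwoSymmetric H →
      ((fromℕ g *ℚ t S H) *ℚ fromℕ (h C 3))
    +ℚ (((½ *ℚ fromℕ (g C 2)) *ℚ fromℕ (h C 2)) *ℚ fromℕ h)
    +ℚ ((fromℕ (g C 3) *ℚ t S G) *ℚ fromℕ (h ^ 3))
    ≡ fromℕ (inducedCount S (inflate G H))
  inflate-numerator {g} {h} G H S symG symH = begin
    _ ≡⟨ cong₂ _+ℚ_ (cong₂ _+ℚ_ within two-blocks) across ⟩
    fromℕ (g * NH) +ℚ fromℕ (eG * (h C 2) * h) +ℚ fromℕ (NG * h ^ 3)
      ≡⟨ sym (trans (fromℕ-homo-+ (g * NH + eG * (h C 2) * h) (NG * h ^ 3))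
                    (cong (_+ℚ fromℕ (NG * h ^ 3)) (fromℕ-homo-+ (g * NH) (eG * (h C 2) * h)))) ⟩
    fromℕ (g * NH + eG * (h C 2) * h + NG * h ^ 3)
      ≡⟨ cong fromℕ (sym (inducedCount-inflate G H S halfG (twoSymmetric⇒halfDense H symH))) ⟩
    fromℕ (inducedCount S (inflate G H)) ∎
    where
      open ≡-Reasoning
      NH = inducedCount S H
      NG = inducedCount S G
      eG = edgeCount G
      halfG = twoSymmetric⇒halfDense G symG
      within : (fromℕ g *ℚ t S H) *ℚ fromℕ (h C 3) ≡ fromℕ (g * NH)
      within = trans (ℚ.*-assoc (fromℕ g) _ _)
                     (trans (cong (fromℕ g *ℚ_) (t-*-choose S H)) (sym (fromℕ-homo-* g NH)))
      two-blocks : ((½ *ℚ fromℕ (g C 2)) *ℚ fromℕ (h C 2)) *ℚ fromℕ h ≡ fromℕ (eG * (h C 2) * h)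
      two-blocks = begin
        ((½ *ℚ fromℕ (g C 2)) *ℚ fromℕ (h C 2)) *ℚ fromℕ h
          ≡⟨ cong (λ c → ((½ *ℚ fromℕ c) *ℚ fromℕ (h C 2)) *ℚ fromℕ h) (sym halfG) ⟩
        ((½ *ℚ fromℕ (2 * eG)) *ℚ fromℕ (h C 2)) *ℚ fromℕ h
          ≡⟨ cong (λ q → (q *ℚ fromℕ (h C 2)) *ℚ fromℕ h) (½-*-double eG) ⟩
        (fromℕ eG *ℚ fromℕ (h C 2)) *ℚ fromℕ h
          ≡⟨ sym (trans (fromℕ-homo-* (eG * (h C 2)) h) (cong (_*ℚ fromℕ h) (fromℕ-homo-* eG (h C 2)))) ⟩
        fromℕ (eG * (h C 2) * h) ∎
      across : (fromℕ (g C 3) *ℚ t S G) *ℚ fromℕ (h ^ 3) ≡ fromℕ (NG * h ^ 3)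
      across = trans (cong (_*ℚ fromℕ (h ^ 3)) (trans (ℚ.*-comm (fromℕ (g C 3)) (t S G)) (t-*-choose S G)))
                     (sym (fromℕ-homo-* NG (h ^ 3)))

open import Defs
open import Data.Nat using (ℕ; _≥_) renaming (_*_ to _*ℕ_; _^_ to _^ℕ_)
open import Data.Nat.Combinatorics using (_C_)
open import Data.Rational using (ℚ; _+_; _*_; ½)
open import Relation.Binary.PropositionalEquality using (_≡_; cong; sym; trans)
open Inflation using (frac-divℕ; inflate-numerator)

mainTheorem11 : ∀ {g h : ℕ} (G : Graph g) (H : Graph h) (S : Graph 3)
    → TwoSymmetric G → TwoSymmetric H → g *ℕ h ≥ 3
    → t S (inflate G H)
    ≡ divℕ ( ((frac g 1 * t S H) * frac (h C 3) 1)
    + (((½ * frac (g C 2) 1) * frac (h C 2) 1) * frac h 1)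
    + ((frac (g C 3) 1 * t S G) * frac (h ^ℕ 3) 1) )
    ((g *ℕ h) C 3)
mainTheorem11 {g} {h} G H S symG symH _ =
  trans (frac-divℕ (inducedCount S (inflate G H)) ((g *ℕ h) C 3))
        (cong (λ q → divℕ q ((g *ℕ h) C 3)) (sym (inflate-numerator G H S symG symH)))
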